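{- Let $R$ be a reduced Rothe pipe dream. Then $R$ is $\Gamma$-free if and only if no box in the subarea of any pipe of $R$ is an elbow tile or a pivot elbow tile.
   Context: For $u\in\mathfrak S_n$, use an $n\times n$ array, box $(i,j)$ in row $i$ from the top, column $j$ from the left. Tiles: empty; horizontal pipe (joins midpoints of left and right edges); vertical pipe (joins midpoints of top and bottom edges); pivot elbow (one arc joining top-edge midpoint to right-edge midpoint); cross (a horizontal and a vertical pipe); elbow (two arcs: top-edge midpoint to right-edge midpoint, and left-edge midpoint to bottom-edge midpoint). A Rothe pipe dream of $u$ is a tiling with: (i) $n$ pipes, each starting at the top edge and ending at the right edge; (ii) $(i,u_i)$ is a pivot elbow for each $i$; (iii) boxes $(i,j)$ with $u^{ -1}(j)<i$, $j<u_i$ are empty; (iv) boxes $(i,j)$ with $u^{ -1}(j)<i$, $j>u_i$ are horizontal pipes; (v) boxes $(i,j)$ with $u^{ -1}(j)>i$, $j<u_i$ are vertical pipes (remaining boxes are crosses or elbows). It is reduced if no two pipes cross more than once. The exit row of a pipe is the row in which it leaves the right edge. A $\Gamma$ pattern is a triple of boxes $(i,j),(i',j),(i,j')$ with $i<i'$ and $j<j'$ such that $(i',j)$ and $(i,j')$ are elbows or pivot elbows, $(i,j)$ is a cross, and the pipe passing horizontally through $(i,j)$ has exit row $i''\ge i'$. A Rothe pipe dream is $\Gamma$-free if it contains no $\Gamma$ pattern. The subarea of a pipe is the set of boxes that lie strictly below, and in the same column as, some box through which the pipe passes horizontally (from the left edge to the right edge of that box), and that do not lie below the exit row of the pipe.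 -}

module Defs where

open import Data.Nat using (ℕ; zero; suc; _≤_)
open import Data.Fin using (Fin; toℕ; _<_; _>_)
open import Data.Fin.Permutation using (Permutation′; _⟨$⟩ʳ_; _⟨$⟩ˡ_)
open import Data.Bool using (Bool; true; false)
open import Data.Maybe using (Maybe; just; nothing)
open import Data.Product using (Σ; ∃; ∃-syntax; _×_)
open import Data.Sum using (_⊎_)
open import Relation.Binary.PropositionalEquality using (_≡_; _≢_)
open import Relation.Nullary using (¬_)

-- Tiles.  pivot = single arc top→right;  elbow = arcs top→right and left→bottom.
data Tile : Set where
  empty horiz vert pivot cross elbow : Tile

-- Box (i , j): row i from the top, column j from the left (0-indexed).
Tiling : ℕ → Set
Tiling n = Fin n → Fin n → Tile

topC botC leftC rightC : Tile → Bool
topC empty = false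
topC horiz = false
topC vert  = true
topC pivot = true
topC cross = true
topC elbow = true
botC empty = false
botC horiz = false
botC vert  = true
botC pivot = false
botC cross = true
botC elbow = true
leftC empty = false
leftC horiz = true
leftC vert  = false
leftC pivot = false
leftC cross = true
leftC elbow = true
rightC empty = false
rightC horiz = true
rightC vert  = false
rightC pivot = true
rightC cross = true
rightC elbow = true

-- Condition (i): the arcs of the tiles glue into n pipes, each entering at the
-- top edge of the array and leaving at its right edge.
PipeTiling : (n : ℕ) → Tiling n → Set
PipeTiling n T =
    (∀ i j j' → toℕ j' ≡ suc (toℕ j) → rightC (T i j) ≡ leftC (T i j'))
  × (∀ i i' j → toℕ i' ≡ suc (toℕ i) → botC (T i j) ≡ topC (T i' j))
  × (∀ i j → toℕ i ≡ 0 → topC (T i j) ≡ true)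
  × (∀ i j → suc (toℕ i) ≡ n → botC (T i j) ≡ false)
  × (∀ i j → toℕ j ≡ 0 → leftC (T i j) ≡ false)
  × (∀ i j → suc (toℕ j) ≡ n → rightC (T i j) ≡ true)

IsRothePD : (n : ℕ) → Permutation′ n → Tiling n → Set
IsRothePD n u T =
    PipeTiling n T
  × (∀ i → T i (u ⟨$⟩ʳ i) ≡ pivot)
  × (∀ i j → (u ⟨$⟩ˡ j) < i → j < (u ⟨$⟩ʳ i) → T i j ≡ empty)
  × (∀ i j → (u ⟨$⟩ˡ j) < i → j > (u ⟨$⟩ʳ i) → T i j ≡ horiz)
  × (∀ i j → (u ⟨$⟩ˡ j) > i → j < (u ⟨$⟩ʳ i) → T i j ≡ vert)
  × (∀ i j → (u ⟨$⟩ˡ j) > i → j > (u ⟨$⟩ʳ i) → (T i j ≡ cross ⊎ T i j ≡ elbow))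

data Dir : Set where
  fromTop fromLeft : Dir

data Out : Set where
  goDown goRight : Out

exitOf : Tile → Dir → Maybe Out
exitOf empty _        = nothing
exitOf horiz fromTop  = nothing
exitOf horiz fromLeft = just goRight
exitOf vert  fromTop  = just goDown
exitOf vert  fromLeft = nothing
exitOf pivot fromTop  = just goRight
exitOf pivot fromLeft = nothing
exitOf cross fromTop  = just goDown
exitOf cross fromLeft = just goRight
exitOf elbow fromTop  = just goRight
exitOf elbow fromLeft = just goDown

-- Visits T p i j d : the pipe starting at the top of column p enters box (i , j) from side d.
data Visits {n : ℕ} (T : Tiling n) (p : Fin n) : Fin n → Fin n → Dir → Set where
  start : ∀ {i} → toℕ i ≡ 0 → Visits T p i p fromTop
  down  : ∀ {i i' j d} → Visits T p i j d → exitOf (T i j) d ≡ just goDown →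
          toℕ i' ≡ suc (toℕ i) → Visits T p i' j fromTop
  right : ∀ {i j j' d} → Visits T p i j d → exitOf (T i j) d ≡ just goRight →
          toℕ j' ≡ suc (toℕ j) → Visits T p i j' fromLeft

PassesH : {n : ℕ} → Tiling n → Fin n → Fin n → Fin n → Set
PassesH T p i j = Visits T p i j fromLeft × exitOf (T i j) fromLeft ≡ just goRight

ExitRow : {n : ℕ} → Tiling n → Fin n → Fin n → Set
ExitRow {n} T p i = ∃[ j ] ∃[ d ] (suc (toℕ j) ≡ n × Visits T p i j d × exitOf (T i j) d ≡ just goRight)

CrossAt : {n : ℕ} → Tiling n → Fin n → Fin n → Fin n → Fin n → Set
CrossAt T p q i j =
  T i j ≡ cross ×
  ((Visits T p i j fromTop × Visits T q i j fromLeft) ⊎ (Visits T q i j fromTop × Visits T p i j fromLeft))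

Reduced : {n : ℕ} → Tiling n → Set
Reduced T = ∀ p q → p ≢ q → ∀ i j i' j' → CrossAt T p q i j → CrossAt T p q i' j' → (i ≡ i' × j ≡ j')

ElbowLike : Tile → Set
ElbowLike t = t ≡ elbow ⊎ t ≡ pivot

GammaPattern : {n : ℕ} → Tiling n → Fin n → Fin n → Fin n → Fin n → Set
GammaPattern T i j i' j' =
  i < i' × j < j' × ElbowLike (T i' j) × ElbowLike (T i j') × T i j ≡ cross ×
  (∃[ p ] (Visits T p i j fromLeft × (∃[ i'' ] (ExitRow T p i'' × toℕ i' ≤ toℕ i''))))

GammaFree : {n : ℕ} → Tiling n → Set
GammaFree T = ∀ i j i' j' → ¬ GammaPattern T i j i' j'

InSubarea : {n : ℕ} → Tiling n → Fin n → Fin n → Fin n → Set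
InSubarea T p k j =
  (∃[ i ] (i < k × PassesH T p i j)) × (∃[ e ] (ExitRow T p e × toℕ k ≤ toℕ e))

{-# OPTIONS --safe #-}
-- A pipe passing horizontally through box (i , j) leaves it either through a
-- horizontal tile, whose bottom edge is blank, so that no tile further down
-- column j has a pipe end on its top edge; or through a cross, and then it runs
-- right along row i.  In the second case, if the pipe exits in a row e > i it
-- must turn down at an elbow (i , j') with j' > j, so an elbow-like tile at
-- (k , j) with i < k ≤ e completes a Γ pattern.  Conversely the lower box of a
-- Γ pattern lies in the subarea of the pipe crossing its corner.
module Submission where

open import Defs
open import Data.Nat using (ℕ; zero; suc; _+_; _≤_; _<_)
open import Data.Nat.Properties
  using (≤-refl; ≤-trans; n≤1+n; n≮n; <-≤-trans; +-comm; m≤n⇒∃[o]m+o≡n)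
open import Data.Fin using (Fin; toℕ; fromℕ<) renaming (_<_ to _<ᶠ_)
open import Data.Fin.Properties using (toℕ-injective; toℕ<n; toℕ-fromℕ<)
open import Data.Fin.Permutation using (Permutation′)
open import Data.Product using (_×_; _,_; Σ; ∃-syntax; proj₁; proj₂)
open import Data.Sum using (_⊎_; inj₁; inj₂)
open import Data.Maybe using (just)
open import Data.Bool using (false)
open import Data.Empty using (⊥-elim)
open import Relation.Nullary using (¬_)
open import Relation.Binary.PropositionalEquality using (_≡_; _≢_; refl; sym; trans; cong; subst)

down≢right : just goDown ≢ just goRight
down≢right ()

down-from-left⇒elbow : ∀ t → exitOf t fromLeft ≡ just goDown → t ≡ elbow
down-from-left⇒elbow elbow _ = refl

right-from-left⇒horiz⊎cross : ∀ t → exitOf t fromLeft ≡ just goRight → t ≡ horiz ⊎ t ≡ cross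
right-from-left⇒horiz⊎cross horiz _ = inj₁ refl
right-from-left⇒horiz⊎cross cross _ = inj₂ refl

top-blank⇒bottom-blank : ∀ t → topC t ≡ false → botC t ≡ false
top-blank⇒bottom-blank empty _ = refl
top-blank⇒bottom-blank horiz _ = refl

top-blank⇒¬elbowLike : ∀ t → topC t ≡ false → ¬ ElbowLike t
top-blank⇒¬elbowLike .elbow () (inj₁ refl)
top-blank⇒¬elbowLike .pivot () (inj₂ refl)

row-above : ∀ {n m} (k : Fin n) → toℕ k ≡ suc m → Σ (Fin n) λ k′ → toℕ k′ ≡ m
row-above k k≡ = fromℕ< m<n , toℕ-fromℕ< m<n
  where
  m<n = ≤-trans (n≤1+n _) (subst (λ x → suc x ≤ _) k≡ (toℕ<n k))

module _ {n : ℕ} (T : Tiling n) where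

  ColumnsGlue : Set
  ColumnsGlue = ∀ i i′ j → toℕ i′ ≡ suc (toℕ i) → botC (T i j) ≡ topC (T i′ j)

  blank-below : ColumnsGlue → ∀ {i k j} → botC (T i j) ≡ false → toℕ i < toℕ k →
                topC (T k j) ≡ false
  blank-below glue {i} {k} {j} bottom i<k =
    let d , i+1+d≡k = m≤n⇒∃[o]m+o≡n i<k
    in go d k (sym (trans (cong suc (+-comm d (toℕ i))) i+1+d≡k))
    where
    go : ∀ d k → toℕ k ≡ suc (d + toℕ i) → topC (T k j) ≡ false
    go zero    k k≡ = trans (sym (glue i k j k≡)) bottom
    go (suc d) k k≡ =
      let k′ , k′≡ = row-above k k≡
      in trans (sym (glue k′ k j (trans k≡ (cong suc (sym k′≡)))))
               (top-blank⇒bottom-blank _ (go d k′ k′≡))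

  -- Unlike Visits, a Path is extended at its front, which is what comparing two
  -- routes from a common entry needs.
  data Path : Fin n → Fin n → Dir → Fin n → Fin n → Dir → Set where
    here      : ∀ {i j d} → Path i j d i j d
    stepDown  : ∀ {i i₁ j d i′ j′ d′} → exitOf (T i j) d ≡ just goDown → toℕ i₁ ≡ suc (toℕ i) →
                Path i₁ j fromTop i′ j′ d′ → Path i j d i′ j′ d′
    stepRight : ∀ {i j j₁ d i′ j′ d′} → exitOf (T i j) d ≡ just goRight → toℕ j₁ ≡ suc (toℕ j) →
                Path i j₁ fromLeft i′ j′ d′ → Path i j d i′ j′ d′

  path-snocDown : ∀ {i j d i′ j′ d′ i₂} → Path i j d i′ j′ d′ → exitOf (T i′ j′) d′ ≡ just goDown →
                  toℕ i₂ ≡ suc (toℕ i′) → Path i j d i₂ j′ fromTop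
  path-snocDown here                e i₂≡ = stepDown e i₂≡ here
  path-snocDown (stepDown  e′ ≡₁ π) e i₂≡ = stepDown  e′ ≡₁ (path-snocDown π e i₂≡)
  path-snocDown (stepRight e′ ≡₁ π) e i₂≡ = stepRight e′ ≡₁ (path-snocDown π e i₂≡)

  path-snocRight : ∀ {i j d i′ j′ d′ j₂} → Path i j d i′ j′ d′ → exitOf (T i′ j′) d′ ≡ just goRight →
                   toℕ j₂ ≡ suc (toℕ j′) → Path i j d i′ j₂ fromLeft
  path-snocRight here                e j₂≡ = stepRight e j₂≡ here
  path-snocRight (stepDown  e′ ≡₁ π) e j₂≡ = stepDown  e′ ≡₁ (path-snocRight π e j₂≡)
  path-snocRight (stepRight e′ ≡₁ π) e j₂≡ = stepRight e′ ≡₁ (path-snocRight π e j₂≡)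

  visits⇒path : ∀ {p i j d} → Visits T p i j d → Σ (Fin n) λ i₀ → toℕ i₀ ≡ 0 × Path i₀ p fromTop i j d
  visits⇒path (start i≡0) = _ , i≡0 , here
  visits⇒path (down v e i′≡) =
    let i₀ , i₀≡0 , π = visits⇒path v in i₀ , i₀≡0 , path-snocDown π e i′≡
  visits⇒path (right v e j′≡) =
    let i₀ , i₀≡0 , π = visits⇒path v in i₀ , i₀≡0 , path-snocRight π e j′≡

  -- Tiles are deterministic, so two paths from the same entry are prefixes of one another.
  path-comparable : ∀ {i j d a b c x y z} → Path i j d a b c → Path i j d x y z →
                    Path a b c x y z ⊎ Path x y z a b c
  path-comparable here π = inj₁ π
  path-comparable π here = inj₂ π
  path-comparable (stepDown {i₁ = i₁} _ ≡₁ π) (stepDown {i₁ = i₁′} _ ≡₁′ π′)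
    with toℕ-injective {i = i₁} {j = i₁′} (trans ≡₁ (sym ≡₁′))
  ... | refl = path-comparable π π′
  path-comparable (stepDown e _ _) (stepRight e′ _ _) = ⊥-elim (down≢right (trans (sym e) e′))
  path-comparable (stepRight e _ _) (stepDown e′ _ _) = ⊥-elim (down≢right (trans (sym e′) e))
  path-comparable (stepRight {j₁ = j₁} _ ≡₁ π) (stepRight {j₁ = j₁′} _ ≡₁′ π′)
    with toℕ-injective {i = j₁} {j = j₁′} (trans ≡₁ (sym ≡₁′))
  ... | refl = path-comparable π π′

  visits-comparable : ∀ {p a b c x y z} → Visits T p a b c → Visits T p x y z →
                      Path a b c x y z ⊎ Path x y z a b c
  visits-comparable v w with visits⇒path v | visits⇒path w
  ... | i₀ , i₀≡0 , π | i₀′ , i₀′≡0 , π′ with toℕ-injective {i = i₀} {j = i₀′} (trans i₀≡0 (sym i₀′≡0))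
  ... | refl = path-comparable π π′

  path-row-mono : ∀ {i j d a b c} → Path i j d a b c → toℕ i ≤ toℕ a
  path-row-mono here               = ≤-refl
  path-row-mono (stepDown _ ≡₁ π)  = ≤-trans (n≤1+n _) (subst (_≤ _) ≡₁ (path-row-mono π))
  path-row-mono (stepRight _ _ π)  = path-row-mono π

  path-leaves-row-at-elbow : ∀ {i j a b c} → Path i j fromLeft a b c → toℕ i < toℕ a →
                             ∃[ j′ ] (toℕ j ≤ toℕ j′ × T i j′ ≡ elbow)
  path-leaves-row-at-elbow here i<i = ⊥-elim (n≮n _ i<i)
  path-leaves-row-at-elbow {j = j} (stepDown e _ _) _ = j , ≤-refl , down-from-left⇒elbow _ e
  path-leaves-row-at-elbow (stepRight _ ≡₁ π) i<a =
    let j′ , j₁≤j′ , elb = path-leaves-row-at-elbow π i<a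
    in j′ , ≤-trans (n≤1+n _) (subst (_≤ toℕ j′) ≡₁ j₁≤j′) , elb

  elbow-right-of-pass : ∀ {p i j a b c} → PassesH T p i j → Visits T p a b c → toℕ i < toℕ a →
                        ∃[ j′ ] (j <ᶠ j′ × T i j′ ≡ elbow)
  elbow-right-of-pass (v , ex) w i<a with visits-comparable v w
  ... | inj₁ here                = ⊥-elim (n≮n _ i<a)
  ... | inj₁ (stepDown e _ _)    = ⊥-elim (down≢right (trans (sym e) ex))
  ... | inj₁ (stepRight _ ≡₁ π)  =
    let j′ , j₁≤j′ , elb = path-leaves-row-at-elbow π i<a
    in j′ , subst (_≤ toℕ j′) ≡₁ j₁≤j′ , elb
  ... | inj₂ π                   = ⊥-elim (n≮n _ (<-≤-trans i<a (path-row-mono π)))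

  elbow-in-subarea⇒Γ : ColumnsGlue → ∀ {p i j k e} → PassesH T p i j → i <ᶠ k →
                       ExitRow T p e → toℕ k ≤ toℕ e → ElbowLike (T k j) → ∃[ j′ ] GammaPattern T i j k j′
  elbow-in-subarea⇒Γ glue pass@(v , ex) i<k exit@(_ , _ , _ , w , _) k≤e elbowLike
    with right-from-left⇒horiz⊎cross _ ex
  ... | inj₁ isHoriz =
    ⊥-elim (top-blank⇒¬elbowLike _ (blank-below glue (subst (λ t → botC t ≡ false) (sym isHoriz) refl) i<k)
                                   elbowLike)
  ... | inj₂ isCross =
    let j′ , j<j′ , elb = elbow-right-of-pass pass w (<-≤-trans i<k k≤e)
    in j′ , i<k , j<j′ , elbowLike , inj₁ elb , isCross , _ , v , _ , exit , k≤e

  Γ⇒elbow-in-subarea : ∀ {i j i′ j′} → GammaPattern T i j i′ j′ →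
                       ∃[ p ] (InSubarea T p i′ j × ElbowLike (T i′ j))
  Γ⇒elbow-in-subarea {i} (i<i′ , _ , elbowLike , _ , isCross , p , v , exit) =
    p , ((i , i<i′ , v , subst (λ t → exitOf t fromLeft ≡ just goRight) (sym isCross) refl) , exit)
      , elbowLike

lemma3p22 : (n : ℕ) (u : Permutation′ n) (T : Tiling n) → IsRothePD n u T → Reduced T →
    (GammaFree T → ∀ p k j → InSubarea T p k j → ¬ ElbowLike (T k j))
    × ((∀ p k j → InSubarea T p k j → ¬ ElbowLike (T k j)) → GammaFree T)
lemma3p22 n u T rothe _ = Γ-free⇒no-subarea-elbow , no-subarea-elbow⇒Γ-free
  where
  glue : ColumnsGlue T
  glue = proj₁ (proj₂ (proj₁ rothe))

  Γ-free⇒no-subarea-elbow : GammaFree T → ∀ p k j → InSubarea T p k j → ¬ ElbowLike (T k j)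
  Γ-free⇒no-subarea-elbow Γ-free p k j ((i , i<k , pass) , (e , exit , k≤e)) elbowLike =
    let j′ , Γ = elbow-in-subarea⇒Γ T glue pass i<k exit k≤e elbowLike in Γ-free i j k j′ Γ

  no-subarea-elbow⇒Γ-free : (∀ p k j → InSubarea T p k j → ¬ ElbowLike (T k j)) → GammaFree T
  no-subarea-elbow⇒Γ-free noElbow i j i′ j′ Γ =
    let p , inSubarea , elbowLike = Γ⇒elbow-in-subarea T Γ in noElbow p i′ j inSubarea elbowLike
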